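{- Let $n\ge 11$. Then there exists a $4$-uniform hypergraph $\mathcal{H}=(V,\mathcal{E})$ with $EI(\mathcal{H})=C_n$ and $|\mathcal{E}|=n$.
   Context: Hypergraphs $\mathcal{H}=(V,\mathcal{E})$ have no multiple hyperedges; isolated vertices are allowed. $\mathcal{H}$ is $4$-uniform if every hyperedge has exactly $4$ elements. The edge intersection hypergraph of $\mathcal{H}$ is $EI(\mathcal{H})=(V,\mathcal{E}^{EI})$ with $\mathcal{E}^{EI}=\{e_1\cap e_2: e_1,e_2\in\mathcal{E},\ e_1\ne e_2,\ |e_1\cap e_2|\ge 2\}$. $C_n$ is the cycle with vertex set $\{1,\dots,n\}$ and edges $\{i,i+1\}$, $i=1,\dots,n$ (indices mod $n$); "$EI(\mathcal{H})=C_n$" means $V=\{1,\dots,n\}$ and $\mathcal{E}^{EI}$ is exactly the edge set of $C_n$. -}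

module Defs where

open import Data.Nat using (ℕ; suc; _≤_; _%_)
open import Data.Nat.DivMod using (m%n<n)
open import Data.Fin using (Fin; toℕ; fromℕ<)
open import Data.Fin.Subset using (Subset; _∩_; _∪_; ⁅_⁆; ∣_∣)
open import Data.Product using (Σ; _×_)
open import Relation.Binary.PropositionalEquality using (_≡_; _≢_)
open import Function.Definitions using (Injective)
open import Function.Bundles using (_⇔_)

-- Vertices are Fin n = {0,…,n-1} (relabelling of {1,…,n}).
-- A hypergraph on Fin n with m hyperedges: an injective family
-- Fin m → Subset n (injectivity = no multiple hyperedges).
record Hypergraph (n m : ℕ) : Set where
  field
    edge      : Fin m → Subset n
    edge-inj  : Injective _≡_ _≡_ edge

open Hypergraph public

Uniform : ∀ {n m} → ℕ → Hypergraph n m → Set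
Uniform k H = ∀ i → ∣ edge H i ∣ ≡ k

IsEIEdge : ∀ {n m} → Hypergraph n m → Subset n → Set
IsEIEdge H S =
  Σ _ λ i → Σ _ λ j → i ≢ j × S ≡ (edge H i ∩ edge H j) × 2 ≤ ∣ S ∣

cycSuc : ∀ {n} → Fin n → Fin n
cycSuc {suc m} i = fromℕ< (m%n<n (suc (toℕ i)) (suc m))

IsCycleEdge : ∀ n → Subset n → Set
IsCycleEdge n S = Σ (Fin n) λ k → S ≡ (⁅ k ⁆ ∪ ⁅ cycSuc k ⁆)

EIisCycle : ∀ {n m} → Hypergraph n m → Set
EIisCycle {n} H = ∀ (S : Subset n) → IsEIEdge H S ⇔ IsCycleEdge n S

-- The hyperedges are the n translates e k = k + {0, 1, 2, 5} modulo n.  The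
-- translates e i and e (i + t) share the vertex i + a exactly when t ≡ a − b
-- (mod n) for some a, b in {0, 1, 2, 5}.  Among these differences only
-- 1 = 1 − 0 = 2 − 1 occurs twice, and since n ≥ 11 the residues 0, ±1, …, ±5
-- are pairwise distinct.  Hence e i ∩ e (i + 1) = {i + 1, i + 2} is an edge of
-- the cycle while any other two translates meet in at most one vertex, which
-- also makes the translates pairwise distinct.
module Submission where

open import Defs
open import Data.Nat using (ℕ; zero; suc; _+_; _*_; _∸_; _≤_; _<_; _%_; z≤n; s≤s; NonZero)
open import Data.Nat.Properties
open import Data.Nat.DivMod
  using (_mod_; m%n<n; m<n⇒m%n≡m; [m+n]%n≡m%n; [m+kn]%n≡m%n; m%n%n≡m%n; %-distribˡ-+)
open import Data.Fin using (Fin; zero; suc; toℕ)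
import Data.Fin.Properties as Fin
open import Data.Fin.Subset using (Subset; _∩_; _∪_; ⁅_⁆; ∣_∣; _∈_; _∉_; inside; outside; ⊥)
open import Data.Fin.Subset.Properties
  using ( x∈p∩q⁺; x∈p∩q⁻; x∈p∪q⁺; x∈p∪q⁻; x∈⁅x⁆; x∈⁅y⁆⇒x≡y; x≢y⇒x∉⁅y⁆; ∉⊥; ∣⁅x⁆∣≡1
        ; ∣⊥∣≡0; ∪-identityˡ; ∩-comm; ∩-idem; ⊆-antisym; p⊆q⇒∣p∣≤∣q∣; nonempty?; Empty-unique)
open import Data.Empty using (⊥-elim)
open import Data.List using (List; []; _∷_; length)
open import Data.List.Membership.Propositional using () renaming (_∈_ to _∈ˡ_)
open import Data.List.Relation.Unary.All as All using (All; []; _∷_; all?)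
open import Data.List.Relation.Unary.Any using (here; there)
open import Data.List.Relation.Unary.Unique.Propositional using (Unique)
open import Data.List.Relation.Unary.Unique.DecPropositional _≟_ using (unique?)
open import Data.List.Relation.Unary.AllPairs using (_∷_)
open import Data.Product using (Σ; _×_; _,_; ∃₂)
open import Data.Sum using (_⊎_; inj₁; inj₂)
open import Data.Vec using (_∷_)
open import Data.Vec.Base using (here; there)
open import Function using (_∘_)
open import Function.Definitions using (Injective)
open import Function.Bundles using (mk⇔)
open import Relation.Binary.PropositionalEquality
open import Relation.Nullary using (yes; no; contradiction)
open import Relation.Nullary.Decidable using (from-yes; _→-dec_; _⊎-dec_)

open import Algebra.Properties.CommutativeSemigroup +-commutativeSemigroup
  using (xy∙z≈xz∙y; x∙yz≈z∙yx; x∙yz≈y∙zx; x∙yz≈y∙xz)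

∣⁅x⁆∪p∣≡1+∣p∣ : ∀ {n} {x : Fin n} (p : Subset n) → x ∉ p → ∣ ⁅ x ⁆ ∪ p ∣ ≡ suc ∣ p ∣
∣⁅x⁆∪p∣≡1+∣p∣ {x = zero}  (inside  ∷ p) x∉p = contradiction here x∉p
∣⁅x⁆∪p∣≡1+∣p∣ {x = zero}  (outside ∷ p) x∉p = cong (suc ∘ ∣_∣) (∪-identityˡ p)
∣⁅x⁆∪p∣≡1+∣p∣ {x = suc x} (inside  ∷ p) x∉p = cong suc (∣⁅x⁆∪p∣≡1+∣p∣ p (x∉p ∘ there))
∣⁅x⁆∪p∣≡1+∣p∣ {x = suc x} (outside ∷ p) x∉p = ∣⁅x⁆∪p∣≡1+∣p∣ p (x∉p ∘ there)

∣p∣≤1 : ∀ {n} (p : Subset n) → (∀ {x y} → x ∈ p → y ∈ p → x ≡ y) → ∣ p ∣ ≤ 1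
∣p∣≤1 {n} p x≡y with nonempty? p
... | yes (x , x∈p) = subst (∣ p ∣ ≤_) (∣⁅x⁆∣≡1 x) (p⊆q⇒∣p∣≤∣q∣ p⊆⁅x⁆)
  where
  p⊆⁅x⁆ : ∀ {y} → y ∈ p → y ∈ ⁅ x ⁆
  p⊆⁅x⁆ y∈p = subst (_∈ ⁅ x ⁆) (x≡y x∈p y∈p) (x∈⁅x⁆ x)
... | no  p-empty = subst (_≤ 1) (sym (trans (cong ∣_∣ (Empty-unique p-empty)) (∣⊥∣≡0 n))) z≤n

-- t + b ≡ a (mod n) for t, b < n: the sum either stays below n or wraps around once.
data SumMod (n t b a : ℕ) : Set where
  below : t + b ≡ a     → SumMod n t b a
  wraps : t + b ≡ a + n → SumMod n t b a

%⇒SumMod : ∀ {n t b a} .{{_ : NonZero n}} → t < n → b < n → (t + b) % n ≡ a → SumMod n t b a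
%⇒SumMod {n} {t} {b} {a} t<n b<n t+b%n≡a with t + b <? n
... | yes t+b<n = below (trans (sym (m<n⇒m%n≡m t+b<n)) t+b%n≡a)
... | no  t+b≮n = wraps (begin
    t + b           ≡⟨ m∸n+n≡m n≤t+b ⟨
    t + b ∸ n + n   ≡⟨ cong (_+ n) t+b∸n≡a ⟩
    a + n           ∎)
  where
  open ≡-Reasoning
  n≤t+b : n ≤ t + b
  n≤t+b = ≮⇒≥ t+b≮n
  t+b∸n≡a : t + b ∸ n ≡ a
  t+b∸n≡a = begin
    t + b ∸ n             ≡⟨ m<n⇒m%n≡m (m<n+o⇒m∸n<o (t + b) n (+-mono-< t<n b<n)) ⟨
    (t + b ∸ n) % n       ≡⟨ [m+n]%n≡m%n (t + b ∸ n) n ⟨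
    (t + b ∸ n + n) % n   ≡⟨ cong (_% n) (m∸n+n≡m n≤t+b) ⟩
    (t + b) % n           ≡⟨ t+b%n≡a ⟩
    a                     ∎

SumMod-below : ∀ {n t b a} → t + b < n → SumMod n t b a → t + b ≡ a
SumMod-below _ (below t+b≡a) = t+b≡a
SumMod-below {n} {a = a} t+b<n (wraps t+b≡a+n) =
  contradiction (subst (n ≤_) (sym t+b≡a+n) (m≤n+m n a)) (<⇒≱ t+b<n)

SumMod-refl : ∀ {n t a} → t < n → SumMod n t a a → t ≡ 0
SumMod-refl {t = t} {a} _ (below t+a≡a) = +-cancelʳ-≡ a t 0 t+a≡a
SumMod-refl {n} {t} {a} t<n (wraps t+a≡a+n) =
  contradiction (+-cancelʳ-≡ a t n (trans t+a≡a+n (+-comm a n))) (<⇒≢ t<n)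

SumMod-suc : ∀ {n t b} → t < n → SumMod n t b (suc b) → t ≡ 1
SumMod-suc {t = t} {b} _ (below t+b≡1+b) = +-cancelʳ-≡ b t 1 t+b≡1+b
SumMod-suc {n} {t} {b} t<n (wraps t+b≡1+b+n) =
  contradiction (+-cancelʳ-≡ b t (suc n) (trans t+b≡1+b+n (cong suc (+-comm b n))))
                (<⇒≢ (m<n⇒m<1+n t<n))

SumMod-pred : ∀ {n t a} → t < n → SumMod n t (suc a) a → suc t ≡ n
SumMod-pred {t = t} {a} _ (below t+1+a≡a) =
  ⊥-elim (<-irrefl refl (subst (a <_) t+1+a≡a (m≤n+m (suc a) t)))
SumMod-pred {n} {t} {a} t<n (wraps t+1+a≡a+n) =
  +-cancelʳ-≡ a (suc t) n (trans (sym (+-suc t a)) (trans t+1+a≡a+n (+-comm a n)))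

-- Since a + b′ and a′ + b stay below n, both representations of t wrap around equally
-- often, so a − b = a′ − b′ holds in ℤ.
SumMod-cross : ∀ {n t a b a′ b′} → a + b′ < n → a′ + b < n →
               SumMod n t b a → SumMod n t b′ a′ → a + b′ ≡ a′ + b
SumMod-cross {n} {t} {a} {b} {a′} {b′} a+b′<n a′+b<n = cases
  where
  cross : ∀ {x y} → t + b ≡ x → t + b′ ≡ y → x + b′ ≡ y + b
  cross refl refl = xy∙z≈xz∙y t b b′
  n≤ : ∀ x y → n ≤ x + n + y
  n≤ x y = ≤-trans (m≤n+m n x) (m≤m+n (x + n) y)
  cases : SumMod n t b a → SumMod n t b′ a′ → a + b′ ≡ a′ + b
  cases (below t+b≡a)   (below t+b′≡a′)   = cross t+b≡a t+b′≡a′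
  cases (wraps t+b≡a+n) (wraps t+b′≡a′+n) = +-cancelʳ-≡ n _ _ (begin
    a + b′ + n   ≡⟨ xy∙z≈xz∙y a n b′ ⟨
    a + n + b′   ≡⟨ cross t+b≡a+n t+b′≡a′+n ⟩
    a′ + n + b   ≡⟨ xy∙z≈xz∙y a′ n b ⟩
    a′ + b + n   ∎)
    where open ≡-Reasoning
  cases (below t+b≡a)   (wraps t+b′≡a′+n) =
    contradiction (subst (n ≤_) (sym (cross t+b≡a t+b′≡a′+n)) (n≤ a′ b)) (<⇒≱ a+b′<n)
  cases (wraps t+b≡a+n) (below t+b′≡a′)   =
    contradiction (subst (n ≤_) (cross t+b≡a+n t+b′≡a′) (n≤ a b′)) (<⇒≱ a′+b<n)

-- Arithmetic modulo n, stated for n = suc m so that cycSuc reduces.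
module Shift (m : ℕ) where

  n : ℕ
  n = suc m

  %-+-congˡ : ∀ z {x y} → x % n ≡ y % n → (z + x) % n ≡ (z + y) % n
  %-+-congˡ z {x} {y} x≡y = begin
    (z + x) % n           ≡⟨ %-distribˡ-+ z x n ⟩
    (z % n + x % n) % n   ≡⟨ cong (λ r → (z % n + r) % n) x≡y ⟩
    (z % n + y % n) % n   ≡⟨ %-distribˡ-+ z y n ⟨
    (z + y) % n           ∎
    where open ≡-Reasoning

  %-cancelˡ-+ : ∀ c {a b} → (c + a) % n ≡ (c + b) % n → a % n ≡ b % n
  %-cancelˡ-+ c {a} {b} c+a≡c+b = begin
    a % n                   ≡⟨ [m+kn]%n≡m%n a c n ⟨
    (a + c * n) % n         ≡⟨ cong (_% n) (regroup a) ⟩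
    (c * m + (c + a)) % n   ≡⟨ %-+-congˡ (c * m) c+a≡c+b ⟩
    (c * m + (c + b)) % n   ≡⟨ cong (_% n) (regroup b) ⟨
    (b + c * n) % n         ≡⟨ [m+kn]%n≡m%n b c n ⟩
    b % n                   ∎
    where
    open ≡-Reasoning
    regroup : ∀ x → x + c * n ≡ c * m + (c + x)
    regroup x = trans (cong (x +_) (*-suc c m)) (x∙yz≈z∙yx x c (c * m))

  shift : Fin n → ℕ → Fin n
  shift k a = (toℕ k + a) mod n

  toℕ-shift : ∀ k a → toℕ (shift k a) ≡ (toℕ k + a) % n
  toℕ-shift k a = Fin.toℕ-fromℕ< _

  shift-zero : ∀ k → shift k 0 ≡ k
  shift-zero k = Fin.toℕ-injective (begin
    toℕ (shift k 0)   ≡⟨ toℕ-shift k 0 ⟩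
    (toℕ k + 0) % n   ≡⟨ cong (_% n) (+-identityʳ (toℕ k)) ⟩
    toℕ k % n         ≡⟨ m<n⇒m%n≡m (Fin.toℕ<n k) ⟩
    toℕ k             ∎)
    where open ≡-Reasoning

  shift-n : ∀ k → shift k n ≡ k
  shift-n k = Fin.toℕ-injective (begin
    toℕ (shift k n)   ≡⟨ toℕ-shift k n ⟩
    (toℕ k + n) % n   ≡⟨ [m+n]%n≡m%n (toℕ k) n ⟩
    toℕ k % n         ≡⟨ m<n⇒m%n≡m (Fin.toℕ<n k) ⟩
    toℕ k             ∎)
    where open ≡-Reasoning

  shift-shift : ∀ k a b → shift (shift k a) b ≡ shift k (a + b)
  shift-shift k a b = Fin.toℕ-injective (begin
    toℕ (shift (shift k a) b)     ≡⟨ toℕ-shift (shift k a) b ⟩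
    (toℕ (shift k a) + b) % n     ≡⟨ cong (λ r → (r + b) % n) (toℕ-shift k a) ⟩
    ((toℕ k + a) % n + b) % n     ≡⟨ cong (_% n) (+-comm _ b) ⟩
    (b + (toℕ k + a) % n) % n     ≡⟨ %-+-congˡ b (m%n%n≡m%n (toℕ k + a) n) ⟩
    (b + (toℕ k + a)) % n         ≡⟨ cong (_% n) (x∙yz≈y∙zx b (toℕ k) a) ⟩
    (toℕ k + (a + b)) % n         ≡⟨ toℕ-shift k (a + b) ⟨
    toℕ (shift k (a + b))         ∎)
    where open ≡-Reasoning

  shift-1≡cycSuc : ∀ k → shift k 1 ≡ cycSuc k
  shift-1≡cycSuc k = cong (_mod n) (+-comm (toℕ k) 1)

  shift-wraps-around : ∀ k {t} → suc t ≡ n → shift (shift k t) 1 ≡ k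
  shift-wraps-around k {t} 1+t≡n = begin
    shift (shift k t) 1   ≡⟨ shift-shift k t 1 ⟩
    shift k (t + 1)       ≡⟨ cong (shift k) (trans (+-comm t 1) 1+t≡n) ⟩
    shift k n             ≡⟨ shift-n k ⟩
    k                     ∎
    where open ≡-Reasoning

  shift-injective : ∀ k {a b} → a < n → b < n → shift k a ≡ shift k b → a ≡ b
  shift-injective k {a} {b} a<n b<n ka≡kb = begin
    a       ≡⟨ m<n⇒m%n≡m a<n ⟨
    a % n   ≡⟨ %-cancelˡ-+ (toℕ k) (trans (sym (toℕ-shift k a)) (trans (cong toℕ ka≡kb) (toℕ-shift k b))) ⟩
    b % n   ≡⟨ m<n⇒m%n≡m b<n ⟩
    b       ∎
    where open ≡-Reasoning

  shift-difference : ∀ i j → Σ ℕ λ t → t < n × j ≡ shift i t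
  shift-difference i j = t , m%n<n (toℕ j + (n ∸ toℕ i)) n , sym (Fin.toℕ-injective (begin
    toℕ (shift i t)                          ≡⟨ toℕ-shift i t ⟩
    (toℕ i + t) % n                          ≡⟨ %-+-congˡ (toℕ i) (m%n%n≡m%n (toℕ j + (n ∸ toℕ i)) n) ⟩
    (toℕ i + (toℕ j + (n ∸ toℕ i))) % n      ≡⟨ cong (_% n) (x∙yz≈y∙xz (toℕ i) (toℕ j) (n ∸ toℕ i)) ⟩
    (toℕ j + (toℕ i + (n ∸ toℕ i))) % n      ≡⟨ cong (λ r → (toℕ j + r) % n) (m+[n∸m]≡n (<⇒≤ (Fin.toℕ<n i))) ⟩
    (toℕ j + n) % n                          ≡⟨ [m+n]%n≡m%n (toℕ j) n ⟩
    toℕ j % n                                ≡⟨ m<n⇒m%n≡m (Fin.toℕ<n j) ⟩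
    toℕ j                                    ∎))
    where
    open ≡-Reasoning
    t : ℕ
    t = (toℕ j + (n ∸ toℕ i)) % n

  shift≡shift⇒SumMod : ∀ i {t a b} → t < n → a < n → b < n →
                       shift (shift i t) b ≡ shift i a → SumMod n t b a
  shift≡shift⇒SumMod i {t} {a} {b} t<n a<n b<n itb≡ia = %⇒SumMod t<n b<n (begin
    (t + b) % n   ≡⟨ %-cancelˡ-+ (toℕ i) (begin
                       (toℕ i + (t + b)) % n     ≡⟨ toℕ-shift i (t + b) ⟨
                       toℕ (shift i (t + b))     ≡⟨ cong toℕ (trans (sym (shift-shift i t b)) itb≡ia) ⟩
                       toℕ (shift i a)           ≡⟨ toℕ-shift i a ⟩
                       (toℕ i + a) % n           ∎) ⟩
    a % n         ≡⟨ m<n⇒m%n≡m a<n ⟩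
    a             ∎)
    where open ≡-Reasoning

  translate : Fin n → List ℕ → Subset n
  translate k []       = ⊥
  translate k (a ∷ as) = ⁅ shift k a ⁆ ∪ translate k as

  ∈-translate⁺ : ∀ k {a as} → a ∈ˡ as → shift k a ∈ translate k as
  ∈-translate⁺ k (here refl)  = x∈p∪q⁺ (inj₁ (x∈⁅x⁆ _))
  ∈-translate⁺ k (there a∈as) = x∈p∪q⁺ (inj₂ (∈-translate⁺ k a∈as))

  ∈-translate⁻ : ∀ k as {x} → x ∈ translate k as → Σ ℕ λ a → a ∈ˡ as × x ≡ shift k a
  ∈-translate⁻ k []       x∈⊥ = ⊥-elim (∉⊥ x∈⊥)
  ∈-translate⁻ k (a ∷ as) x∈  with x∈p∪q⁻ ⁅ shift k a ⁆ (translate k as) x∈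
  ... | inj₁ x∈⁅ka⁆ = a , here refl , x∈⁅y⁆⇒x≡y _ x∈⁅ka⁆
  ... | inj₂ x∈kas  with ∈-translate⁻ k as x∈kas
  ...   | b , b∈as , x≡kb = b , there b∈as , x≡kb

  ∣translate∣ : ∀ k {as} → Unique as → All (_< n) as → ∣ translate k as ∣ ≡ length as
  ∣translate∣ k {[]}     _             _            = ∣⊥∣≡0 n
  ∣translate∣ k {a ∷ as} (a∉as ∷ uniq) (a<n ∷ as<n) =
    trans (∣⁅x⁆∪p∣≡1+∣p∣ _ ka∉kas) (cong suc (∣translate∣ k uniq as<n))
    where
    ka∉kas : shift k a ∉ translate k as
    ka∉kas ka∈kas with ∈-translate⁻ k as ka∈kas
    ... | b , b∈as , ka≡kb =
      All.lookup a∉as b∈as (shift-injective k a<n (All.lookup as<n b∈as) ka≡kb)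

base : List ℕ
base = 0 ∷ 1 ∷ 2 ∷ 5 ∷ []

base-unique : Unique base
base-unique = from-yes (unique? base)

base-≤5 : All (_≤ 5) base
base-≤5 = from-yes (all? (_≤? 5) base)

base-successor : All (λ a → All (λ b → suc b ≡ a → a ≡ 1 ⊎ a ≡ 2) base) base
base-successor = from-yes (all? (λ a → all? (λ b →
  (suc b ≟ a) →-dec (a ≟ 1 ⊎-dec a ≟ 2)) base) base)

-- a + b′ ≡ a′ + b says a − b = a′ − b′: the only nonzero difference occurring twice is ±1.
base-differences : All (λ a → All (λ b → All (λ a′ → All (λ b′ →
  a + b′ ≡ a′ + b → a ≡ a′ ⊎ a ≡ b ⊎ a ≡ suc b ⊎ b ≡ suc a) base) base) base) base
base-differences = from-yes (all? (λ a → all? (λ b → all? (λ a′ → all? (λ b′ →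
  (a + b′ ≟ a′ + b) →-dec (a ≟ a′ ⊎-dec a ≟ b ⊎-dec a ≟ suc b ⊎-dec b ≟ suc a))
  base) base) base) base)

module Construction (m : ℕ) (11≤n : 11 ≤ suc m) where

  open Shift m

  ≤10⇒<n : ∀ {k} → k ≤ 10 → k < n
  ≤10⇒<n k≤10 = ≤-trans (s≤s k≤10) 11≤n

  ∈base⇒≤5 : ∀ {a} → a ∈ˡ base → a ≤ 5
  ∈base⇒≤5 = All.lookup base-≤5

  ∈base⇒<n : ∀ {a} → a ∈ˡ base → a < n
  ∈base⇒<n a∈base = ≤10⇒<n (≤-trans (∈base⇒≤5 a∈base) (m≤m+n 5 5))

  ∈base⇒+<n : ∀ {a b} → a ∈ˡ base → b ∈ˡ base → a + b < n
  ∈base⇒+<n a∈base b∈base = ≤10⇒<n (+-mono-≤ (∈base⇒≤5 a∈base) (∈base⇒≤5 b∈base))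

  hyperedge : Fin n → Subset n
  hyperedge k = translate k base

  ∈-hyperedge⁺ : ∀ k {a} → a ∈ˡ base → shift k a ∈ hyperedge k
  ∈-hyperedge⁺ k = ∈-translate⁺ k

  cycleEdge : Fin n → Subset n
  cycleEdge k = ⁅ k ⁆ ∪ ⁅ cycSuc k ⁆

  ∣hyperedge∣≡4 : ∀ k → ∣ hyperedge k ∣ ≡ 4
  ∣hyperedge∣≡4 k = ∣translate∣ k base-unique (All.tabulate ∈base⇒<n)

  ∣cycleEdge∣≡2 : ∀ k → ∣ cycleEdge k ∣ ≡ 2
  ∣cycleEdge∣≡2 k = trans (∣⁅x⁆∪p∣≡1+∣p∣ _ (x≢y⇒x∉⁅y⁆ k≢k+1)) (cong suc (∣⁅x⁆∣≡1 (cycSuc k)))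
    where
    k≢k+1 : k ≢ cycSuc k
    k≢k+1 k≡k+1 = 0≢1+n (shift-injective k (≤10⇒<n z≤n) (≤10⇒<n (s≤s z≤n))
                                         (trans (shift-zero k) (trans k≡k+1 (sym (shift-1≡cycSuc k)))))

  ∣IsCycleEdge∣≡2 : ∀ {S} → IsCycleEdge n S → ∣ S ∣ ≡ 2
  ∣IsCycleEdge∣≡2 (k , refl) = ∣cycleEdge∣≡2 k

  hyperedge∩hyperedge⁻ : ∀ i {t x} → t < n → x ∈ hyperedge i ∩ hyperedge (shift i t) →
    ∃₂ λ a b → a ∈ˡ base × b ∈ˡ base × x ≡ shift i a × SumMod n t b a
  hyperedge∩hyperedge⁻ i {t} t<n x∈ with x∈p∩q⁻ (hyperedge i) (hyperedge (shift i t)) x∈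
  ... | x∈i , x∈j with ∈-translate⁻ i base x∈i | ∈-translate⁻ (shift i t) base x∈j
  ... | a , a∈base , x≡ia | b , b∈base , x≡itb =
    a , b , a∈base , b∈base , x≡ia ,
    shift≡shift⇒SumMod i t<n (∈base⇒<n a∈base) (∈base⇒<n b∈base) (trans (sym x≡itb) x≡ia)

  hyperedge∩hyperedge-suc : ∀ i → hyperedge i ∩ hyperedge (shift i 1) ≡ cycleEdge (shift i 1)
  hyperedge∩hyperedge-suc i = ⊆-antisym ⊆cycleEdge cycleEdge⊆
    where
    i+1+1≡i+2 : cycSuc (shift i 1) ≡ shift i 2
    i+1+1≡i+2 = trans (sym (shift-1≡cycSuc (shift i 1))) (shift-shift i 1 1)
    ⊆cycleEdge : ∀ {x} → x ∈ hyperedge i ∩ hyperedge (shift i 1) → x ∈ cycleEdge (shift i 1)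
    ⊆cycleEdge x∈ with hyperedge∩hyperedge⁻ i (≤10⇒<n (s≤s z≤n)) x∈
    ... | a , b , a∈base , b∈base , refl , 1+b≡a
      with All.lookup (All.lookup base-successor a∈base) b∈base
             (SumMod-below (≤10⇒<n (s≤s (≤-trans (∈base⇒≤5 b∈base) (m≤m+n 5 4)))) 1+b≡a)
    ... | inj₁ refl = x∈p∪q⁺ (inj₁ (x∈⁅x⁆ _))
    ... | inj₂ refl = x∈p∪q⁺ (inj₂ (subst (_∈ ⁅ cycSuc (shift i 1) ⁆) i+1+1≡i+2 (x∈⁅x⁆ _)))
    cycleEdge⊆ : ∀ {x} → x ∈ cycleEdge (shift i 1) → x ∈ hyperedge i ∩ hyperedge (shift i 1)
    cycleEdge⊆ x∈ with x∈p∪q⁻ _ _ x∈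
    ... | inj₁ x∈⁅i+1⁆ with x∈⁅y⁆⇒x≡y _ x∈⁅i+1⁆
    ...   | refl = x∈p∩q⁺ ( ∈-hyperedge⁺ i (there (here refl))
                          , subst (_∈ hyperedge (shift i 1)) (shift-zero (shift i 1))
                                  (∈-hyperedge⁺ (shift i 1) (here refl)))
    cycleEdge⊆ x∈ | inj₂ x∈⁅i+2⁆ with x∈⁅y⁆⇒x≡y _ x∈⁅i+2⁆
    ...   | refl = x∈p∩q⁺ ( subst (_∈ hyperedge i) (sym i+1+1≡i+2)
                                  (∈-hyperedge⁺ i (there (there (here refl))))
                          , subst (_∈ hyperedge (shift i 1)) (shift-1≡cycSuc (shift i 1))
                                  (∈-hyperedge⁺ (shift i 1) (there (here refl))))

  difference-unique : ∀ {t a b a′ b′} → t < n → t ≢ 0 → t ≢ 1 → suc t ≢ n →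
    a ∈ˡ base → b ∈ˡ base → a′ ∈ˡ base → b′ ∈ˡ base →
    SumMod n t b a → SumMod n t b′ a′ → a ≡ a′
  difference-unique {t} {a′ = a′} t<n t≢0 t≢1 1+t≢n a∈ b∈ a′∈ b′∈ t+b≡a t+b′≡a′ =
    cases t+b≡a (All.lookup (All.lookup (All.lookup (All.lookup base-differences a∈) b∈) a′∈) b′∈
                            (SumMod-cross (∈base⇒+<n a∈ b′∈) (∈base⇒+<n a′∈ b∈) t+b≡a t+b′≡a′))
    where
    cases : ∀ {a b} → SumMod n t b a → a ≡ a′ ⊎ a ≡ b ⊎ a ≡ suc b ⊎ b ≡ suc a → a ≡ a′
    cases _     (inj₁ a≡a′)               = a≡a′
    cases t+b≡a (inj₂ (inj₁ refl))        = contradiction (SumMod-refl t<n t+b≡a) t≢0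
    cases t+b≡a (inj₂ (inj₂ (inj₁ refl))) = contradiction (SumMod-suc t<n t+b≡a) t≢1
    cases t+b≡a (inj₂ (inj₂ (inj₂ refl))) = contradiction (SumMod-pred t<n t+b≡a) 1+t≢n

  ∣hyperedge∩hyperedge∣≤1 : ∀ i {t} → t < n → t ≢ 0 → t ≢ 1 → suc t ≢ n →
                            ∣ hyperedge i ∩ hyperedge (shift i t) ∣ ≤ 1
  ∣hyperedge∩hyperedge∣≤1 i {t} t<n t≢0 t≢1 1+t≢n = ∣p∣≤1 _ meet-once
    where
    meet-once : ∀ {x y} → x ∈ hyperedge i ∩ hyperedge (shift i t) →
                y ∈ hyperedge i ∩ hyperedge (shift i t) → x ≡ y
    meet-once x∈ y∈ with hyperedge∩hyperedge⁻ i t<n x∈ | hyperedge∩hyperedge⁻ i t<n y∈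
    ... | a , b , a∈ , b∈ , refl , t+b≡a | a′ , b′ , a′∈ , b′∈ , refl , t+b′≡a′ =
      cong (shift i) (difference-unique t<n t≢0 t≢1 1+t≢n a∈ b∈ a′∈ b′∈ t+b≡a t+b′≡a′)

  hyperedge∩hyperedge-cases : ∀ {i j} → i ≢ j →
    IsCycleEdge n (hyperedge i ∩ hyperedge j) ⊎ ∣ hyperedge i ∩ hyperedge j ∣ ≤ 1
  hyperedge∩hyperedge-cases {i} {j} i≢j with shift-difference i j
  ... | t , t<n , refl with t ≟ 0 | t ≟ 1 | suc t ≟ n
  ... | yes refl | _        | _         = contradiction (sym (shift-zero i)) i≢j
  ... | no _     | yes refl | _         = inj₁ (shift i 1 , hyperedge∩hyperedge-suc i)
  ... | no _     | no _     | yes 1+t≡n =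
    inj₁ (shift j 1 , subst (λ k → hyperedge k ∩ hyperedge j ≡ cycleEdge (shift j 1))
                            (shift-wraps-around i 1+t≡n)
                            (trans (∩-comm _ _) (hyperedge∩hyperedge-suc j)))
  ... | no t≢0   | no t≢1   | no 1+t≢n  = inj₂ (∣hyperedge∩hyperedge∣≤1 i t<n t≢0 t≢1 1+t≢n)

  ∣hyperedge∩hyperedge∣≤2 : ∀ {i j} → i ≢ j → ∣ hyperedge i ∩ hyperedge j ∣ ≤ 2
  ∣hyperedge∩hyperedge∣≤2 i≢j with hyperedge∩hyperedge-cases i≢j
  ... | inj₁ isCycleEdge = ≤-reflexive (∣IsCycleEdge∣≡2 isCycleEdge)
  ... | inj₂ ∣∩∣≤1       = m≤n⇒m≤1+n ∣∩∣≤1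

  hyperedge-injective : Injective _≡_ _≡_ hyperedge
  hyperedge-injective {i} {j} eᵢ≡eⱼ with i Fin.≟ j
  ... | yes i≡j = i≡j
  ... | no  i≢j = contradiction (subst (_≤ 2) ∣eᵢ∩eⱼ∣≡4 (∣hyperedge∩hyperedge∣≤2 i≢j))
                                λ { (s≤s (s≤s ())) }
    where
    ∣eᵢ∩eⱼ∣≡4 : ∣ hyperedge i ∩ hyperedge j ∣ ≡ 4
    ∣eᵢ∩eⱼ∣≡4 = trans (cong (λ e → ∣ hyperedge i ∩ e ∣) (sym eᵢ≡eⱼ))
                       (trans (cong ∣_∣ (∩-idem (hyperedge i))) (∣hyperedge∣≡4 i))

  hypergraph : Hypergraph n n
  hypergraph = record { edge = hyperedge ; edge-inj = hyperedge-injective }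

  IsEIEdge⇒IsCycleEdge : ∀ {S} → IsEIEdge hypergraph S → IsCycleEdge n S
  IsEIEdge⇒IsCycleEdge (i , j , i≢j , refl , 2≤∣S∣) with hyperedge∩hyperedge-cases i≢j
  ... | inj₁ isCycleEdge = isCycleEdge
  ... | inj₂ ∣S∣≤1       = contradiction 2≤∣S∣ (≤⇒≯ ∣S∣≤1)

  IsCycleEdge⇒IsEIEdge : ∀ {S} → IsCycleEdge n S → IsEIEdge hypergraph S
  IsCycleEdge⇒IsEIEdge (k , refl) =
    shift k m , k , k-1≢k ,
    sym (subst (λ j → hyperedge (shift k m) ∩ hyperedge j ≡ cycleEdge j)
               (shift-wraps-around k refl) (hyperedge∩hyperedge-suc (shift k m))) ,
    ≤-reflexive (sym (∣cycleEdge∣≡2 k))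
    where
    k-1≢k : shift k m ≢ k
    k-1≢k k-1≡k = <⇒≢ (≤-trans (s≤s z≤n) (≤-pred 11≤n))
                       (sym (shift-injective k ≤-refl (s≤s z≤n) (trans k-1≡k (sym (shift-zero k)))))

  EIisCycle-hypergraph : EIisCycle hypergraph
  EIisCycle-hypergraph S = mk⇔ IsEIEdge⇒IsCycleEdge IsCycleEdge⇒IsEIEdge

theorem5 : (n : ℕ) → 11 ≤ n →
    Σ (Hypergraph n n) λ H → Uniform 4 H × EIisCycle H
theorem5 (suc m) 11≤n = hypergraph , ∣hyperedge∣≡4 , EIisCycle-hypergraph
  where open Construction m 11≤n
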